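{- For any integers $m$ and $n$ satisfying $2 \leq m \leq n$, there exists a graph $G$ such that $|V(G)|=n$ and $k(G)=\theta_E(G)-n+m$.
   Context: All graphs are finite, simple and undirected. The competition graph $C(D)$ of a digraph $D$ is the graph with vertex set $V(D)$ in which distinct $x,y$ are adjacent iff there is a vertex $v$ with $(x,v),(y,v)$ both arcs of $D$. The competition number $k(G)$ of a graph $G$ is the minimum integer $k\ge 0$ such that $G$ together with $k$ new isolated vertices is the competition graph of an acyclic digraph. A clique of $G$ is a vertex subset inducing a complete graph; an edge clique cover is a family of cliques such that each edge has both endpoints in some clique of the family; $\theta_E(G)$ is the minimum size of an edge clique cover of $G$. -}

module Defs where

open import Data.Nat using (ℕ; _+_; _≤_)
open import Data.Bool using (Bool; true; false)
open import Data.Fin using (Fin; splitAt)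
open import Data.Fin.Subset using (Subset; _∈_)
open import Data.Sum using (inj₁; inj₂)
open import Data.Product using (Σ; ∃; _×_)
open import Relation.Nullary using (¬_)
open import Relation.Binary.PropositionalEquality using (_≡_; _≢_)
open import Relation.Binary.Construct.Closure.Transitive using (TransClosure)
open import Function.Bundles using (_⇔_)

record Graph (n : ℕ) : Set where
  field
    adj   : Fin n → Fin n → Bool
    sym   : ∀ x y → adj x y ≡ adj y x
    irrefl : ∀ x → adj x x ≡ false
open Graph public

Edge : ∀ {n} → Graph n → Fin n → Fin n → Set
Edge G x y = adj G x y ≡ true

Digraph : ℕ → Set₁
Digraph N = Fin N → Fin N → Set

Acyclic : ∀ {N} → Digraph N → Set
Acyclic D = ∀ v → ¬ TransClosure D v v

-- Adjacency of G together with k new isolated vertices (vertex set Fin (n + k),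
-- the first n vertices are those of G, the last k are the new isolated ones).
adjPlusIsolated : ∀ {n} → Graph n → (k : ℕ) → Fin (n + k) → Fin (n + k) → Bool
adjPlusIsolated {n} G k x y with splitAt n x | splitAt n y
... | inj₁ a | inj₁ b = adj G a b
... | _      | _      = false

IsCompetitionGraphOf : ∀ {N} → (Fin N → Fin N → Bool) → Digraph N → Set
IsCompetitionGraphOf A D =
  ∀ x y → x ≢ y → (A x y ≡ true ⇔ ∃ λ v → D x v × D y v)

CompetitionRealizable : ∀ {n} → Graph n → ℕ → Set₁
CompetitionRealizable {n} G k =
  Σ (Digraph (n + k)) λ D → Acyclic D × IsCompetitionGraphOf (adjPlusIsolated G k) D

IsCompetitionNumber : ∀ {n} → Graph n → ℕ → Set₁
IsCompetitionNumber G k =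
  CompetitionRealizable G k × (∀ j → CompetitionRealizable G j → k ≤ j)

IsClique : ∀ {n} → Graph n → Subset n → Set
IsClique G C = ∀ x y → x ∈ C → y ∈ C → x ≢ y → Edge G x y

IsEdgeCliqueCover : ∀ {n} → Graph n → (t : ℕ) → (Fin t → Subset n) → Set
IsEdgeCliqueCover G t C =
  (∀ i → IsClique G (C i)) ×
  (∀ x y → Edge G x y → ∃ λ i → x ∈ C i × y ∈ C i)

HasEdgeCliqueCoverOfSize : ∀ {n} → Graph n → ℕ → Set
HasEdgeCliqueCoverOfSize {n} G t = Σ (Fin t → Subset n) (IsEdgeCliqueCover G t)

IsEdgeCliqueCoverNumber : ∀ {n} → Graph n → ℕ → Set
IsEdgeCliqueCoverNumber G t =
  HasEdgeCliqueCoverOfSize G t × (∀ s → HasEdgeCliqueCoverOfSize G s → t ≤ s)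

module Submission where

-- For 2 ≤ m ≤ n, write n = m + o.  The witness is the star K(1,o) on the
-- vertices 0 (the centre) and 1, …, o (the leaves), padded with m ≥ 2
-- isolated vertices o+1, …, n-1.  Then θ_E = o and k = 0, so k + n = θ_E + m.
--
--   * θ_E ≤ o: the o edges of the star are cliques covering all edges
--     (edgeListCover, built from edgeClique).
--   * θ_E ≥ o: a clique contains at most one edge at the centre, since the
--     leaves are pairwise non-adjacent (independentNeighbours⇒≤).
--   * k = 0: the isolated vertices serve as prey.  Leaf c+1 and the centre
--     both prey on vertex c+2 (which exists as c+2 ≤ o+1 < n); every arc
--     increases the vertex number, so the digraph is acyclic (rank⇒acyclic),
--     and two vertices share a prey iff they are the centre and a leaf.

open import Defs
open import Data.Nat using (ℕ; _+_; _≤_)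
open import Data.Product using (Σ; ∃; _×_)
open import Relation.Binary.PropositionalEquality using (_≡_)

open import Data.Nat using (zero; suc; _<_; _<ᵇ_; z≤n; s≤s)
open import Data.Nat.Properties
  using (<ᵇ⇒<; <⇒<ᵇ; ≤-trans; <-trans; <-irrefl; <⇒≤; n<1+n; m≤m+n; +-identityʳ;
         +-monoˡ-≤; +-comm; suc-injective; m≤n⇒∃[o]m+o≡n)
open import Data.Bool using (Bool; true; false)
open import Data.Bool.Properties using (T-≡)
open import Data.Empty using (⊥-elim)
open import Data.Fin using (Fin; toℕ; fromℕ<; splitAt; _↑ˡ_; cast; _≟_)
open import Data.Fin.Properties
  using (toℕ-injective; toℕ-fromℕ<; toℕ-cast; toℕ-↑ˡ; toℕ<n; splitAt-↑ˡ; injective⇒≤)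
open import Data.Fin.Subset using (_∈_; ⁅_⁆; _∪_)
open import Data.Fin.Subset.Properties using (x∈⁅x⁆; x∈⁅y⁆⇒x≡y; x∈p∪q⁻; p⊆p∪q; q⊆p∪q)
open import Data.Sum using (_⊎_; inj₁; inj₂)
open import Data.Product using (_,_; proj₁; proj₂)
open import Function.Bundles using (mk⇔; Equivalence)
open import Function.Definitions using (Injective)
open import Relation.Nullary using (¬_; yes; no)
open import Relation.Binary.PropositionalEquality
  using (refl; trans; cong; cong₂; subst; _≢_) renaming (sym to ≡-sym)
open import Relation.Binary.Construct.Closure.Transitive using (TransClosure; [_]; _∷_)

rank⇒acyclic : ∀ {N} {D : Digraph N} (rank : Fin N → ℕ) →
  (∀ {x y} → D x y → rank x < rank y) → Acyclic D
rank⇒acyclic {D = D} rank increasing v cycle = <-irrefl refl (walk-increases cycle)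
  where
  walk-increases : ∀ {x y} → TransClosure D x y → rank x < rank y
  walk-increases [ arc ]      = increasing arc
  walk-increases (arc ∷ walk) = <-trans (increasing arc) (walk-increases walk)

realizable⇒competitionNumber0 : ∀ {n} {G : Graph n} →
  CompetitionRealizable G 0 → IsCompetitionNumber G 0
realizable⇒competitionNumber0 realization = realization , λ _ _ → z≤n

splitAt-+0 : ∀ n (x : Fin (n + 0)) → splitAt n x ≡ inj₁ (cast (+-identityʳ n) x)
splitAt-+0 n x = subst (λ z → splitAt n z ≡ inj₁ x′) embed-x′ (splitAt-↑ˡ n x′ 0)
  where
  x′ : Fin n
  x′ = cast (+-identityʳ n) x
  embed-x′ : x′ ↑ˡ 0 ≡ x
  embed-x′ = toℕ-injective (trans (toℕ-↑ˡ x′ 0) (toℕ-cast (+-identityʳ n) x))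

adjPlusNoIsolated : ∀ {n} (G : Graph n) (x y : Fin (n + 0)) →
  adjPlusIsolated G 0 x y ≡ adj G (cast (+-identityʳ n) x) (cast (+-identityʳ n) y)
adjPlusNoIsolated {n} G x y rewrite splitAt-+0 n x | splitAt-+0 n y = refl

∈pair : ∀ {n} {u v x : Fin n} → x ∈ ⁅ u ⁆ ∪ ⁅ v ⁆ → x ≡ u ⊎ x ≡ v
∈pair {u = u} {v} x∈ with x∈p∪q⁻ ⁅ u ⁆ ⁅ v ⁆ x∈
... | inj₁ x∈u = inj₁ (x∈⁅y⁆⇒x≡y u x∈u)
... | inj₂ x∈v = inj₂ (x∈⁅y⁆⇒x≡y v x∈v)

edgeClique : ∀ {n} (G : Graph n) {u v : Fin n} → Edge G u v → IsClique G (⁅ u ⁆ ∪ ⁅ v ⁆)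
edgeClique G {u} {v} uv x y x∈ y∈ x≢y with ∈pair x∈ | ∈pair y∈
... | inj₁ refl | inj₁ refl = ⊥-elim (x≢y refl)
... | inj₁ refl | inj₂ refl = uv
... | inj₂ refl | inj₁ refl = trans (Graph.sym G v u) uv
... | inj₂ refl | inj₂ refl = ⊥-elim (x≢y refl)

edgeListCover : ∀ {n t} (G : Graph n) (u v : Fin t → Fin n) →
  (∀ i → Edge G (u i) (v i)) →
  (∀ x y → Edge G x y → ∃ λ i → (x ≡ u i × y ≡ v i) ⊎ (x ≡ v i × y ≡ u i)) →
  HasEdgeCliqueCoverOfSize G t
edgeListCover G u v edge listed = (λ i → ⁅ u i ⁆ ∪ ⁅ v i ⁆) , (λ i → edgeClique G (edge i)) , covers
  where
  u∈ : ∀ i → u i ∈ ⁅ u i ⁆ ∪ ⁅ v i ⁆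
  u∈ i = p⊆p∪q ⁅ v i ⁆ (x∈⁅x⁆ (u i))
  v∈ : ∀ i → v i ∈ ⁅ u i ⁆ ∪ ⁅ v i ⁆
  v∈ i = q⊆p∪q ⁅ u i ⁆ ⁅ v i ⁆ (x∈⁅x⁆ (v i))
  covers : ∀ x y → Edge G x y → ∃ λ i → x ∈ ⁅ u i ⁆ ∪ ⁅ v i ⁆ × y ∈ ⁅ u i ⁆ ∪ ⁅ v i ⁆
  covers x y xy with listed x y xy
  ... | i , inj₁ (refl , refl) = i , u∈ i , v∈ i
  ... | i , inj₂ (refl , refl) = i , v∈ i , u∈ i

-- A vertex c with t distinct, pairwise non-adjacent neighbours forces every
-- edge clique cover to have at least t cliques: a clique containing two of
-- the edges at c would make two of those neighbours adjacent.
independentNeighbours⇒≤ : ∀ {n t s} (G : Graph n) (c : Fin n) (nb : Fin t → Fin n) →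
  Injective _≡_ _≡_ nb → (∀ i → Edge G c (nb i)) → (∀ i j → ¬ Edge G (nb i) (nb j)) →
  HasEdgeCliqueCoverOfSize G s → t ≤ s
independentNeighbours⇒≤ {t = t} {s} G c nb nb-injective spoke independent (C , clique , covers) =
  injective⇒≤ chosen-injective
  where
  chosen : Fin t → Fin s
  chosen i = proj₁ (covers c (nb i) (spoke i))
  nb∈chosen : ∀ i → nb i ∈ C (chosen i)
  nb∈chosen i = proj₂ (proj₂ (covers c (nb i) (spoke i)))
  chosen-injective : Injective _≡_ _≡_ chosen
  chosen-injective {i} {j} same with nb i ≟ nb j
  ... | yes nbi≡nbj = nb-injective nbi≡nbj
  ... | no nbi≢nbj = ⊥-elim (independent i j
          (clique (chosen i) (nb i) (nb j) (nb∈chosen i)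
                  (subst (λ k → nb j ∈ C k) (≡-sym same) (nb∈chosen j)) nbi≢nbj))

-- The star K(1,o) on the vertex numbers 0, …, o, padded with isolated
-- vertices up to n ≥ o + 2, so that the prey vertices 2, …, o + 1 exist.
module Star (o n : ℕ) (room : 2 + o ≤ n) where

  -- Adjacency on vertex numbers: 0 is the centre, suc c (c < o) are the leaves.
  starAdj : ℕ → ℕ → Bool
  starAdj zero    zero    = false
  starAdj zero    (suc c) = c <ᵇ o
  starAdj (suc c) zero    = c <ᵇ o
  starAdj (suc _) (suc _) = false

  starAdj-sym : ∀ a b → starAdj a b ≡ starAdj b a
  starAdj-sym zero    zero    = refl
  starAdj-sym zero    (suc _) = refl
  starAdj-sym (suc _) zero    = refl
  starAdj-sym (suc _) (suc _) = refl

  starAdj-irrefl : ∀ a → starAdj a a ≡ false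
  starAdj-irrefl zero    = refl
  starAdj-irrefl (suc _) = refl

  spoke : ∀ c → c < o → starAdj 0 (suc c) ≡ true
  spoke c c<o = Equivalence.to T-≡ (<⇒<ᵇ c<o)

  starAdj-edge : ∀ a b → starAdj a b ≡ true →
    ∃ λ c → c < o × ((a ≡ 0 × b ≡ suc c) ⊎ (a ≡ suc c × b ≡ 0))
  starAdj-edge zero    (suc c) e = c , <ᵇ⇒< c o (Equivalence.from T-≡ e) , inj₁ (refl , refl)
  starAdj-edge (suc c) zero    e = c , <ᵇ⇒< c o (Equivalence.from T-≡ e) , inj₂ (refl , refl)

  star : Graph n
  star = record
    { adj    = λ x y → starAdj (toℕ x) (toℕ y)
    ; sym    = λ x y → starAdj-sym (toℕ x) (toℕ y)
    ; irrefl = λ x → starAdj-irrefl (toℕ x)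
    }

  number<n : ∀ c → c ≤ suc o → c < n
  number<n c c≤1+o = ≤-trans (s≤s c≤1+o) room

  centre : Fin n
  centre = fromℕ< (number<n 0 z≤n)

  leaf : Fin o → Fin n
  leaf i = fromℕ< (number<n (suc (toℕ i)) (s≤s (<⇒≤ (toℕ<n i))))

  toℕ-leaf : ∀ i → toℕ (leaf i) ≡ suc (toℕ i)
  toℕ-leaf i = toℕ-fromℕ< _

  is-centre : ∀ {x} → toℕ x ≡ 0 → x ≡ centre
  is-centre x≡0 = toℕ-injective (trans x≡0 (≡-sym (toℕ-fromℕ< _)))

  is-leaf : ∀ {x c} (c<o : c < o) → toℕ x ≡ suc c → x ≡ leaf (fromℕ< c<o)
  is-leaf c<o x≡c+1 =
    toℕ-injective (trans x≡c+1 (≡-sym (trans (toℕ-leaf _) (cong suc (toℕ-fromℕ< c<o)))))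

  leaf-injective : Injective _≡_ _≡_ leaf
  leaf-injective {i} {j} same =
    toℕ-injective (suc-injective (trans (≡-sym (toℕ-leaf i)) (trans (cong toℕ same) (toℕ-leaf j))))

  centre-leaf : ∀ i → Edge star centre (leaf i)
  centre-leaf i rewrite toℕ-fromℕ< (number<n 0 z≤n) | toℕ-leaf i = spoke (toℕ i) (toℕ<n i)

  leaves-independent : ∀ i j → ¬ Edge star (leaf i) (leaf j)
  leaves-independent i j rewrite toℕ-leaf i | toℕ-leaf j = λ ()

  star-edges : ∀ x y → Edge star x y →
    ∃ λ i → (x ≡ centre × y ≡ leaf i) ⊎ (x ≡ leaf i × y ≡ centre)
  star-edges x y e with starAdj-edge (toℕ x) (toℕ y) e
  ... | c , c<o , inj₁ (x≡0 , y≡c+1) = fromℕ< c<o , inj₁ (is-centre x≡0 , is-leaf c<o y≡c+1)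
  ... | c , c<o , inj₂ (x≡c+1 , y≡0) = fromℕ< c<o , inj₂ (is-leaf c<o x≡c+1 , is-centre y≡0)

  edgeCliqueCoverNumber : IsEdgeCliqueCoverNumber star o
  edgeCliqueCoverNumber =
    edgeListCover star (λ _ → centre) leaf centre-leaf star-edges ,
    λ s → independentNeighbours⇒≤ star centre leaf leaf-injective centre-leaf leaves-independent

  Preys : ℕ → ℕ → Set
  Preys a w = ∃ λ c → c < o × w ≡ suc (suc c) × (a ≡ 0 ⊎ a ≡ suc c)

  preys-upward : ∀ {a w} → Preys a w → a < w
  preys-upward (c , _ , refl , inj₁ refl) = s≤s z≤n
  preys-upward (c , _ , refl , inj₂ refl) = n<1+n (suc c)

  commonPrey⇒adjacent : ∀ {a b w} → a ≢ b → Preys a w → Preys b w → starAdj a b ≡ true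
  commonPrey⇒adjacent a≢b (_ , _ , refl , inj₁ refl) (_ , _ , refl , inj₁ refl) = ⊥-elim (a≢b refl)
  commonPrey⇒adjacent a≢b (_ , _ , refl , inj₁ refl) (c , c<o , refl , inj₂ refl) = spoke c c<o
  commonPrey⇒adjacent a≢b (c , c<o , refl , inj₂ refl) (_ , _ , refl , inj₁ refl) = spoke c c<o
  commonPrey⇒adjacent a≢b (_ , _ , refl , inj₂ refl) (_ , _ , refl , inj₂ refl) = ⊥-elim (a≢b refl)

  preyDigraph : Digraph (n + 0)
  preyDigraph x w = Preys (toℕ x) (toℕ w)

  prey : ∀ c → c < o → Fin (n + 0)
  prey c c<o = fromℕ< (≤-trans (number<n (suc (suc c)) (s≤s c<o)) (m≤m+n n 0))

  adjacent⇒commonPrey : ∀ a b → starAdj a b ≡ true →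
    ∃ λ (w : Fin (n + 0)) → Preys a (toℕ w) × Preys b (toℕ w)
  adjacent⇒commonPrey a b e with starAdj-edge a b e
  ... | c , c<o , inj₁ (refl , refl) =
        prey c c<o , (c , c<o , toℕ-fromℕ< _ , inj₁ refl) , (c , c<o , toℕ-fromℕ< _ , inj₂ refl)
  ... | c , c<o , inj₂ (refl , refl) =
        prey c c<o , (c , c<o , toℕ-fromℕ< _ , inj₂ refl) , (c , c<o , toℕ-fromℕ< _ , inj₁ refl)

  adjPlusIsolated-star : ∀ x y → adjPlusIsolated star 0 x y ≡ starAdj (toℕ x) (toℕ y)
  adjPlusIsolated-star x y =
    trans (adjPlusNoIsolated star x y)
          (cong₂ starAdj (toℕ-cast (+-identityʳ n) x) (toℕ-cast (+-identityʳ n) y))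

  star-competition : IsCompetitionGraphOf (adjPlusIsolated star 0) preyDigraph
  star-competition x y x≢y = mk⇔
    (λ e → adjacent⇒commonPrey (toℕ x) (toℕ y) (trans (≡-sym (adjPlusIsolated-star x y)) e))
    (λ { (w , x→w , y→w) → trans (adjPlusIsolated-star x y)
           (commonPrey⇒adjacent (λ same → x≢y (toℕ-injective same)) x→w y→w) })

  competitionNumber : IsCompetitionNumber star 0
  competitionNumber = realizable⇒competitionNumber0
    (preyDigraph , rank⇒acyclic toℕ preys-upward , star-competition)

mainTheorem1 : (m n : ℕ) → 2 ≤ m → m ≤ n →
    Σ (Graph n) λ G → ∃ λ k → ∃ λ t →
    IsCompetitionNumber G k × IsEdgeCliqueCoverNumber G t × k + n ≡ t + m
mainTheorem1 m n 2≤m m≤n with m≤n⇒∃[o]m+o≡n m≤n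
... | o , refl = S.star , 0 , o , S.competitionNumber , S.edgeCliqueCoverNumber , +-comm m o
  where
  module S = Star o (m + o) (+-monoˡ-≤ o 2≤m)
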